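{- Let $A\subseteq[1..m^2]$ be a nonempty set of size $|A|=m$, written $A=\{a_1<\dots<a_m\}$, and let $a_0=-\infty$. Let $T=\big(\bigodot_{i=1}^{m}0^{a_i}1^{m-i+2}\big)\cdot\big(0^{m^2+1}1\big)\cdot\big(0^{m^2}1^{m+2}\big)\in\{0,1\}^*$. Then for every $x\in[1..m^2]$, $\mathrm{Pred}(A,x)=a_i$, where $\Delta=|T|-(m^2+m+2)$ and $i=(x+m+1)-\mathrm{PLCP}_T[\Delta+m^2-x+1]$.
   Context: $\mathrm{Pred}(A,x)=\max(\{y\in A:y<x\}\cup\{ -\infty\})$. $c^k$ denotes $k$ copies of symbol $c$, $0\prec 1$. Lexicographic order: a proper prefix is smaller, otherwise compare at first difference. For a string $S$ of length $N$: $\mathrm{SA}_S$ lists its suffix starting positions in increasing lexicographic order, $\mathrm{ISA}_S$ is its inverse; $\mathrm{LCE}_S(i,j)$ is the length of the longest common prefix of $S[i..N]$ and $S[j..N]$; $\Phi_S[j]=\mathrm{SA}_S[\mathrm{ISA}_S[j]-1]$ for $j\ne\mathrm{SA}_S[1]$; $\mathrm{PLCP}_S[\mathrm{SA}_S[1]]=0$ and $\mathrm{PLCP}_S[j]=\mathrm{LCE}_S(j,\Phi_S[j])$ for $j\ne \mathrm{SA}_S[1]$. -}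

module Defs where

open import Data.Bool using (Bool; true; false; if_then_else_; _∧_)
open import Data.Nat using (ℕ; zero; suc; _+_; _*_; _∸_; _≤_; _<_; _<ᵇ_; _≡ᵇ_; _⊔_)
open import Data.List using (List; []; _∷_; _++_; replicate; length; drop; filter; concat; map)
open import Data.Maybe using (Maybe; just; nothing)
open import Relation.Nullary.Decidable using (does)
open import Relation.Binary.PropositionalEquality using (_≡_)

-- Strings over {0,1}: 0 = false, 1 = true, with 0 ≺ 1.
Str : Set
Str = List Bool

symLt : Bool → Bool → Bool
symLt false true = true
symLt _     _    = false

symEq : Bool → Bool → Bool
symEq false false = true
symEq true  true  = true
symEq _     _     = false

lexLt : Str → Str → Bool
lexLt []       []       = false
lexLt []       (_ ∷ _)  = true
lexLt (_ ∷ _)  []       = false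
lexLt (c ∷ u)  (d ∷ v)  = if symLt c d then true else (if symEq c d then lexLt u v else false)

lcp : Str → Str → ℕ
lcp (c ∷ u) (d ∷ v) = if symEq c d then suc (lcp u v) else 0
lcp _       _       = 0

-- 1-based suffix S[i..N]
suf : Str → ℕ → Str
suf S i = drop (i ∸ 1) S

pos : ℕ → List ℕ
pos zero    = []
pos (suc n) = pos n ++ (suc n ∷ [])

LCE : Str → ℕ → ℕ → ℕ
LCE S i j = lcp (suf S i) (suf S j)

ISA : Str → ℕ → ℕ
ISA S j = suc (length (filter (λ k → lexLt (suf S k) (suf S j) Data.Bool.≟ true) (pos (length S))))

-- SA_S[r] = the position whose suffix has rank r (0 if none)
findFirst : (ℕ → Bool) → List ℕ → ℕ
findFirst p []       = 0
findFirst p (k ∷ ks) = if p k then k else findFirst p ks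

SA : Str → ℕ → ℕ
SA S r = findFirst (λ k → ISA S k ≡ᵇ r) (pos (length S))

Φ : Str → ℕ → ℕ
Φ S j = SA S (ISA S j ∸ 1)

PLCP : Str → ℕ → ℕ
PLCP S j = if ISA S j ≡ᵇ 1 then 0 else LCE S j (Φ S j)

-- Values in ℕ ∪ {-∞}: nothing = -∞
maxM : Maybe ℕ → Maybe ℕ → Maybe ℕ
maxM nothing  b        = b
maxM a        nothing  = a
maxM (just a) (just b) = just (a ⊔ b)

Pred : List ℕ → ℕ → Maybe ℕ
Pred []       x = nothing
Pred (y ∷ ys) x = if y <ᵇ x then maxM (just y) (Pred ys x) else Pred ys x

-- a_i for A = {a_1 < ... < a_m} given as the increasing list (a_1,...,a_m); a_0 = -∞
nth : List ℕ → ℕ → Maybe ℕ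
nth []       _       = nothing
nth (y ∷ ys) zero    = just y
nth (y ∷ ys) (suc k) = nth ys k

elt : List ℕ → ℕ → Maybe ℕ
elt as zero    = nothing
elt as (suc k) = nth as k

-- ⊙_{i=j}^{m} 0^{a_i} 1^{m-i+2}, with the list starting at a_j
blocks : ℕ → ℕ → List ℕ → Str
blocks m i []       = []
blocks m i (a ∷ as) = replicate a false ++ replicate ((m ∸ i) + 2) true ++ blocks m (suc i) as

T : ℕ → List ℕ → Str
T m as = blocks m 1 as ++ (replicate (m * m + 1) false ++ (true ∷ []))
                       ++ (replicate (m * m) false ++ replicate (m + 2) true)

{-# OPTIONS --safe #-}
-- Split T into runs 0^z 1^o: a run (a_j, m − j + 2) for each element of A, then (m² + 1, 1)
-- and (m², m + 2); the 1-runs have pairwise distinct lengths.  The suffix starting at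
-- Δ + m² − x + 1 is v = 0^x 1^(m+2).  Let a be the first of a_1, …, a_m, m² + 1 that is at
-- least x; the 1-run after it has length k = m + 1 − i, where a_1, …, a_i are the elements
-- of A below x.  The suffix u = 0^x 1^k … starting x symbols before the end of the zero run
-- of a is the lexicographic predecessor of v: a suffix strictly between them would start
-- exactly x zeros before a 1-run of length strictly between k and m + 2, and such runs only
-- follow the zero runs a_1, …, a_i, which are shorter than x.  So Φ_T maps v to u and
-- PLCP_T = lcp(v, u) = x + k there, whence (x + m + 1) − PLCP_T = i and Pred(A, x) = a_i.
module Submission where

open import Defs
open import Data.Bool using (Bool; true; false; if_then_else_)
import Data.Bool as Bool
open import Data.Bool.Properties using (T-≡)
open import Data.List using (List; []; _∷_; _++_; [_]; length; replicate; drop; filter)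
open import Data.List.Properties using (++-assoc; ++-identityʳ; length-++; length-replicate; length-drop; drop-all; drop-[]; filter-++)
open import Data.List.Membership.Propositional using (_∈_)
open import Data.List.Membership.Propositional.Properties using (∈-++⁺ˡ; ∈-++⁺ʳ; ∈-++⁻)
open import Data.List.Relation.Unary.All using (All; []; _∷_)
import Data.List.Relation.Unary.All as All
open import Data.List.Relation.Unary.Any using (here; there)
import Data.List.Relation.Unary.AllPairs as AllPairs
open import Data.List.Relation.Unary.Linked using (Linked)
import Data.List.Relation.Unary.Linked as Linked
open import Data.List.Relation.Unary.Linked.Properties using (Linked⇒AllPairs)
open import Data.Maybe using (just; nothing)
open import Data.Nat using (ℕ; zero; suc; _+_; _*_; _∸_; _≤_; _<_; z≤n; s≤s; _≡ᵇ_; _<ᵇ_)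
open import Data.Nat.Properties
open import Data.Product using (_×_; _,_; proj₁; proj₂; ∃)
open import Data.Sum using (_⊎_; inj₁; inj₂; [_,_]′)
open import Function using (_∘_)
open import Function.Bundles using (Equivalence)
open import Relation.Binary.Definitions using (tri<; tri≈; tri>)
open import Relation.Binary.PropositionalEquality using (_≡_; _≢_; refl; sym; trans; cong; cong₂; subst; module ≡-Reasoning)
open import Relation.Nullary using (¬_; Dec; yes; no; contradiction)
open import Relation.Nullary.Reflects using (ofʸ; ofⁿ)

open ≡-Reasoning

infix 4 _⊏_

_⊏_ : Str → Str → Set
u ⊏ w = lexLt u w ≡ true

lexLt-irrefl : ∀ w → lexLt w w ≡ false
lexLt-irrefl [] = refl
lexLt-irrefl (false ∷ w) = lexLt-irrefl w
lexLt-irrefl (true ∷ w) = lexLt-irrefl w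

⊏-irrefl : ∀ w → ¬ w ⊏ w
⊏-irrefl w w⊏w = contradiction (trans (sym w⊏w) (lexLt-irrefl w)) λ ()

⊏-[] : ∀ w → ¬ w ⊏ []
⊏-[] [] ()
⊏-[] (_ ∷ _) ()

⊏-trans : ∀ a b c → a ⊏ b → b ⊏ c → a ⊏ c
⊏-trans [] b [] _ b⊏[] = contradiction b⊏[] (⊏-[] b)
⊏-trans [] _ (_ ∷ _) _ _ = refl
⊏-trans (_ ∷ _) [] _ () _
⊏-trans (_ ∷ _) (_ ∷ _) [] _ ()
⊏-trans (false ∷ a) (false ∷ b) (false ∷ c) a⊏b b⊏c = ⊏-trans a b c a⊏b b⊏c
⊏-trans (false ∷ _) (false ∷ _) (true ∷ _) _ _ = refl
⊏-trans (false ∷ _) (true ∷ _) (false ∷ _) _ ()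
⊏-trans (false ∷ _) (true ∷ _) (true ∷ _) _ _ = refl
⊏-trans (true ∷ _) (false ∷ _) _ () _
⊏-trans (true ∷ _) (true ∷ _) (false ∷ _) _ ()
⊏-trans (true ∷ a) (true ∷ b) (true ∷ c) a⊏b b⊏c = ⊏-trans a b c a⊏b b⊏c

≢⇒⊏⊎⊐ : ∀ {a b} → a ≢ b → a ⊏ b ⊎ b ⊏ a
≢⇒⊏⊎⊐ {[]} {[]} a≢b = contradiction refl a≢b
≢⇒⊏⊎⊐ {[]} {_ ∷ _} _ = inj₁ refl
≢⇒⊏⊎⊐ {_ ∷ _} {[]} _ = inj₂ refl
≢⇒⊏⊎⊐ {false ∷ _} {false ∷ _} a≢b = ≢⇒⊏⊎⊐ (a≢b ∘ cong (false ∷_))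
≢⇒⊏⊎⊐ {false ∷ _} {true ∷ _} _ = inj₁ refl
≢⇒⊏⊎⊐ {true ∷ _} {false ∷ _} _ = inj₂ refl
≢⇒⊏⊎⊐ {true ∷ _} {true ∷ _} a≢b = ≢⇒⊏⊎⊐ (a≢b ∘ cong (true ∷_))

lexLt-++ˡ : ∀ p a c → lexLt (p ++ a) (p ++ c) ≡ lexLt a c
lexLt-++ˡ [] a c = refl
lexLt-++ˡ (false ∷ p) a c = lexLt-++ˡ p a c
lexLt-++ˡ (true ∷ p) a c = lexLt-++ˡ p a c

lcp-++ˡ : ∀ p a c → lcp (p ++ a) (p ++ c) ≡ length p + lcp a c
lcp-++ˡ [] a c = refl
lcp-++ˡ (false ∷ p) a c = cong suc (lcp-++ˡ p a c)
lcp-++ˡ (true ∷ p) a c = cong suc (lcp-++ˡ p a c)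

⊏-++⁺ˡ : ∀ p {a c} → a ⊏ c → (p ++ a) ⊏ (p ++ c)
⊏-++⁺ˡ p {a} {c} = trans (lexLt-++ˡ p a c)

⊏-++⁻ˡ : ∀ p {a c} → (p ++ a) ⊏ (p ++ c) → a ⊏ c
⊏-++⁻ˡ p {a} {c} = trans (sym (lexLt-++ˡ p a c))

indicator : Bool → ℕ
indicator true = 1
indicator false = 0

indicator-mono : ∀ {b c} → (b ≡ true → c ≡ true) → indicator b ≤ indicator c
indicator-mono {false} _ = z≤n
indicator-mono {true} b⇒c rewrite b⇒c refl = ≤-refl

count : (ℕ → Bool) → ℕ → ℕ
count f zero = 0
count f (suc n) = count f n + indicator (f (suc n))

count-pos : ∀ f n → length (filter (λ k → f k Bool.≟ true) (pos n)) ≡ count f n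
count-pos f zero = refl
count-pos f (suc n) = begin
  length (filter P? (pos n ++ [ suc n ]))
    ≡⟨ cong length (filter-++ P? (pos n) [ suc n ]) ⟩
  length (filter P? (pos n) ++ filter P? [ suc n ])
    ≡⟨ length-++ (filter P? (pos n)) ⟩
  length (filter P? (pos n)) + length (filter P? [ suc n ])
    ≡⟨ cong₂ _+_ (count-pos f n) (singleton (suc n)) ⟩
  count f n + indicator (f (suc n)) ∎
  where
  P? : ∀ k → Dec (f k ≡ true)
  P? k = f k Bool.≟ true
  singleton : ∀ k → length (filter P? [ k ]) ≡ indicator (f k)
  singleton k with f k
  ... | true = refl
  ... | false = refl

module _ {f g : ℕ → Bool} where

  count-cong : ∀ {n} → (∀ {i} → i < n → f (suc i) ≡ g (suc i)) → count f n ≡ count g n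
  count-cong {zero} _ = refl
  count-cong {suc n} f≗g =
    cong₂ _+_ (count-cong (λ i<n → f≗g (m<n⇒m<1+n i<n))) (cong indicator (f≗g (n<1+n n)))

  count-mono : ∀ {n} → (∀ {i} → i < n → g (suc i) ≡ true → f (suc i) ≡ true)
    → count g n ≤ count f n
  count-mono {zero} _ = z≤n
  count-mono {suc n} g⇒f =
    +-mono-≤ (count-mono (λ i<n → g⇒f (m<n⇒m<1+n i<n))) (indicator-mono (g⇒f (n<1+n n)))

  count-mono-< : ∀ {n p} → (∀ {i} → i < n → g (suc i) ≡ true → f (suc i) ≡ true)
    → p < n → f (suc p) ≡ true → g (suc p) ≡ false → count g n < count f n
  count-mono-< {suc n} g⇒f p<1+n fp gp with m<1+n⇒m<n∨m≡n p<1+n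
  ... | inj₁ p<n = +-mono-<-≤ (count-mono-< (λ i<n → g⇒f (m<n⇒m<1+n i<n)) p<n fp gp)
                              (indicator-mono (g⇒f (n<1+n n)))
  ... | inj₂ refl rewrite fp | gp = +-mono-≤-< (count-mono (λ i<n → g⇒f (m<n⇒m<1+n i<n))) (s≤s z≤n)

  count-insert : ∀ {n p} → (∀ {i} → i < n → i ≢ p → f (suc i) ≡ g (suc i))
    → p < n → f (suc p) ≡ true → g (suc p) ≡ false → count f n ≡ suc (count g n)
  count-insert {suc n} f≗g p<1+n fp gp with m<1+n⇒m<n∨m≡n p<1+n
  ... | inj₁ p<n = cong₂ _+_ (count-insert (λ i<n → f≗g (m<n⇒m<1+n i<n)) p<n fp gp)
                             (cong indicator (f≗g (n<1+n n) (>⇒≢ p<n)))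
  ... | inj₂ refl rewrite fp | gp = begin
    count f n + 1       ≡⟨ +-comm (count f n) 1 ⟩
    suc (count f n)     ≡⟨ cong suc (count-cong (λ i<n → f≗g (m<n⇒m<1+n i<n) (<⇒≢ i<n))) ⟩
    suc (count g n)     ≡⟨ cong suc (+-identityʳ (count g n)) ⟨
    suc (count g n + 0) ∎

pos-complete : ∀ {n i} → i < n → suc i ∈ pos n
pos-complete {suc n} i<1+n with m<1+n⇒m<n∨m≡n i<1+n
... | inj₁ i<n = ∈-++⁺ˡ (pos-complete i<n)
... | inj₂ refl = ∈-++⁺ʳ (pos n) (here refl)

pos-sound : ∀ {n k} → k ∈ pos n → ∃ λ i → k ≡ suc i × i < n
pos-sound {suc n} k∈ with ∈-++⁻ (pos n) k∈
... | inj₁ k∈pos = let i , k≡1+i , i<n = pos-sound k∈pos in i , k≡1+i , m<n⇒m<1+n i<n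
... | inj₂ (here k≡1+n) = n , k≡1+n , n<1+n n

findFirst-unique : ∀ (P : ℕ → Bool) {p} xs → p ∈ xs → P p ≡ true
  → (∀ {q} → q ∈ xs → P q ≡ true → q ≡ p) → findFirst P xs ≡ p
findFirst-unique P (x ∷ xs) p∈ Pp unique with P x in Px | p∈
... | true  | _ = unique (here refl) Px
... | false | here refl = contradiction (trans (sym Pp) Px) λ ()
... | false | there p∈xs = findFirst-unique P xs p∈xs Pp (unique ∘ there)

drop-injective : ∀ (s : Str) {i j} → i ≤ length s → j ≤ length s → drop i s ≡ drop j s → i ≡ j
drop-injective s {i} {j} i≤ j≤ e =
  ∸-cancelˡ-≡ i≤ j≤ (trans (sym (length-drop i s)) (trans (cong length e) (length-drop j s)))

drop≢[]⇒< : ∀ (s : Str) {i} → drop i s ≢ [] → i < length s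
drop≢[]⇒< s {i} ne = ≰⇒> (λ |s|≤i → ne (drop-all i s |s|≤i))

ISA-count : ∀ S j → ISA S j ≡ suc (count (λ k → lexLt (suf S k) (suf S j)) (length S))
ISA-count S j = cong suc (count-pos (λ k → lexLt (suf S k) (suf S j)) (length S))

ISA-mono : ∀ S {i j} → i < length S → drop i S ⊏ drop j S → ISA S (suc i) < ISA S (suc j)
ISA-mono S {i} {j} i< i⊏j rewrite ISA-count S (suc i) | ISA-count S (suc j) =
  s≤s (count-mono-< (λ {k} _ k⊏i → ⊏-trans (drop k S) (drop i S) (drop j S) k⊏i i⊏j)
                    i< i⊏j (lexLt-irrefl (drop i S)))

ISA-injective : ∀ S {i j} → i < length S → j < length S → ISA S (suc i) ≡ ISA S (suc j) → i ≡ j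
ISA-injective S {i} {j} i< j< e with i ≟ j
... | yes i≡j = i≡j
... | no i≢j with ≢⇒⊏⊎⊐ (i≢j ∘ drop-injective S (<⇒≤ i<) (<⇒≤ j<))
...   | inj₁ i⊏j = contradiction e (<⇒≢ (ISA-mono S {i} {j} i< i⊏j))
...   | inj₂ j⊏i = contradiction (sym e) (<⇒≢ (ISA-mono S {j} {i} j< j⊏i))

SA-ISA : ∀ S {i} → i < length S → SA S (ISA S (suc i)) ≡ suc i
SA-ISA S {i} i< = findFirst-unique (λ k → ISA S k ≡ᵇ ISA S (suc i)) (pos (length S))
  (pos-complete {length S} i<) (Equivalence.to T-≡ (≡⇒≡ᵇ (ISA S (suc i)) _ refl)) unique
  where
  unique : ∀ {q} → q ∈ pos (length S) → (ISA S q ≡ᵇ ISA S (suc i)) ≡ true → q ≡ suc i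
  unique q∈ e with pos-sound {length S} q∈
  ... | j , refl , j< = cong suc (ISA-injective S j< i< (≡ᵇ⇒≡ _ _ (Equivalence.from T-≡ e)))

AllSuffixes : (Str → Set) → Str → Set
AllSuffixes P s = ∀ n → P (drop n s)

Between : Str → Str → Str → Set
Between u v w = u ⊏ w × w ⊏ v

NoSuffixBetween : Str → Str → Str → Set
NoSuffixBetween u v = AllSuffixes (¬_ ∘ Between u v)

ISA-succ : ∀ S {i j} → i < length S → drop i S ⊏ drop j S → NoSuffixBetween (drop i S) (drop j S) S
  → ISA S (suc j) ≡ suc (ISA S (suc i))
ISA-succ S {i} {j} i< i⊏j gap =
  trans (ISA-count S (suc j)) (cong suc (trans
    (count-insert agree i< i⊏j (lexLt-irrefl (drop i S)))
    (sym (ISA-count S (suc i)))))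
  where
  agree : ∀ {k} → k < length S → k ≢ i → lexLt (drop k S) (drop j S) ≡ lexLt (drop k S) (drop i S)
  agree {k} k< k≢i with lexLt (drop k S) (drop i S) in k⊏ᵇi
  ... | true = ⊏-trans (drop k S) (drop i S) (drop j S) k⊏ᵇi i⊏j
  ... | false with lexLt (drop k S) (drop j S) in k⊏ᵇj
  ...   | false = refl
  ...   | true with ≢⇒⊏⊎⊐ (k≢i ∘ drop-injective S (<⇒≤ k<) (<⇒≤ i<))
  ...     | inj₁ k⊏i = contradiction (trans (sym k⊏i) k⊏ᵇi) λ ()
  ...     | inj₂ i⊏k = contradiction (i⊏k , k⊏ᵇj) (gap k)

PLCP-predecessor : ∀ S {i j u v} → i < length S → drop i S ≡ u → drop j S ≡ v → u ⊏ v
  → NoSuffixBetween u v S → PLCP S (suc j) ≡ lcp v u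
PLCP-predecessor S {i} {j} i< refl refl i⊏j gap = begin
  PLCP S (suc j)
    ≡⟨ cong (λ r → if r ≡ᵇ 1 then 0 else LCE S (suc j) (SA S (r ∸ 1))) (ISA-succ S {i} {j} i< i⊏j gap) ⟩
  LCE S (suc j) (SA S (ISA S (suc i)))
    ≡⟨ cong (LCE S (suc j)) (SA-ISA S i<) ⟩
  LCE S (suc j) (suc i) ∎

0^_ 1^_ : ℕ → Str
0^ n = replicate n false
1^ n = replicate n true

runs : List (ℕ × ℕ) → Str
runs [] = []
runs ((z , o) ∷ L) = 0^ z ++ 1^ o ++ runs L

runs-++ : ∀ L L′ → runs (L ++ L′) ≡ runs L ++ runs L′
runs-++ [] L′ = refl
runs-++ ((z , o) ∷ L) L′ = begin
  0^ z ++ 1^ o ++ runs (L ++ L′)     ≡⟨ cong (λ w → 0^ z ++ 1^ o ++ w) (runs-++ L L′) ⟩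
  0^ z ++ 1^ o ++ runs L ++ runs L′   ≡⟨ cong (0^ z ++_) (++-assoc (1^ o) (runs L) (runs L′)) ⟨
  0^ z ++ (1^ o ++ runs L) ++ runs L′ ≡⟨ ++-assoc (0^ z) (1^ o ++ runs L) (runs L′) ⟨
  (0^ z ++ 1^ o ++ runs L) ++ runs L′ ∎

data NoLeadingOne : Str → Set where
  [] : NoLeadingOne []
  0∷_ : ∀ w → NoLeadingOne (false ∷ w)

noLeadingOne-0^ : ∀ {z} w → 1 ≤ z → NoLeadingOne (0^ z ++ w)
noLeadingOne-0^ w (s≤s z≤n) = 0∷ _

0^-≢[] : ∀ {z} w → 1 ≤ z → 0^ z ++ w ≢ []
0^-≢[] w (s≤s z≤n) ()

¬⊏-earlier-one : ∀ {z x o} w w′ → z < x → 1 ≤ o → ¬ (0^ z ++ 1^ o ++ w) ⊏ (0^ x ++ w′)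
¬⊏-earlier-one {zero} {suc x} w w′ _ (s≤s z≤n) ()
¬⊏-earlier-one {suc z} {suc x} w w′ (s≤s z<x) o≥1 = ¬⊏-earlier-one w w′ z<x o≥1

¬⊏-ones-prefix : ∀ {M o} w → M ≤ o → ¬ (1^ o ++ w) ⊏ 1^ M
¬⊏-ones-prefix {zero} {o} w _ = ⊏-[] (1^ o ++ w)
¬⊏-ones-prefix {suc M} {suc o} w (s≤s M≤o) = ¬⊏-ones-prefix w M≤o

⊏-fewer-ones : ∀ {o k w} w′ → o < k → NoLeadingOne w → (1^ o ++ w) ⊏ (1^ k ++ w′)
⊏-fewer-ones {zero} {suc k} w′ _ [] = refl
⊏-fewer-ones {zero} {suc k} w′ _ (0∷ _) = refl
⊏-fewer-ones {suc o} {suc k} w′ (s≤s o<k) nl = ⊏-fewer-ones w′ o<k nl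

lcp-fewer-ones : ∀ {o k w} → o < k → NoLeadingOne w → lcp (1^ k) (1^ o ++ w) ≡ o
lcp-fewer-ones {zero} {suc k} _ [] = refl
lcp-fewer-ones {zero} {suc k} _ (0∷ _) = refl
lcp-fewer-ones {suc o} {suc k} (s≤s o<k) nl = cong suc (lcp-fewer-ones o<k nl)

drop-replicate-++ : ∀ {d z} (b : Bool) (w : Str) → d ≤ z
  → drop d (replicate z b ++ w) ≡ replicate (z ∸ d) b ++ w
drop-replicate-++ b w z≤n = refl
drop-replicate-++ b w (s≤s d≤z) = drop-replicate-++ b w d≤z

drop-∸-replicate-++ : ∀ {x z} (b : Bool) (w : Str) → x ≤ z
  → drop (z ∸ x) (replicate z b ++ w) ≡ replicate x b ++ w
drop-∸-replicate-++ {x} {z} b w x≤z =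
  trans (drop-replicate-++ b w (m∸n≤m z x)) (cong (λ n → replicate n b ++ w) (m∸[m∸n]≡n x≤z))

drop-++ : ∀ (p : Str) {s} n → drop (length p + n) (p ++ s) ≡ drop n s
drop-++ [] n = refl
drop-++ (_ ∷ p) n = drop-++ p n

Suffix : Str → Str → Set
Suffix u s = ∃ λ n → drop n s ≡ u

suffix-replicate-++ : ∀ {x} z (b : Bool) (w : Str) → x ≤ z → Suffix (replicate x b ++ w) (replicate z b ++ w)
suffix-replicate-++ {x} z b w x≤z = z ∸ x , drop-∸-replicate-++ b w x≤z

suffix-++ : ∀ p {u s} → Suffix u s → Suffix u (p ++ s)
suffix-++ [] sfx = sfx
suffix-++ (_ ∷ p) sfx with suffix-++ p sfx
... | n , e = suc n , e

allSuffixes-replicate : ∀ {P : Str → Set} (b : Bool) z (w : Str)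
  → (∀ {y} → y < z → P (replicate (suc y) b ++ w))
  → AllSuffixes P w → AllSuffixes P (replicate z b ++ w)
allSuffixes-replicate b zero w _ rest = rest
allSuffixes-replicate b (suc z) w each rest zero = each (n<1+n z)
allSuffixes-replicate {P} b (suc z) w each rest (suc n) =
  allSuffixes-replicate {P} b z w (λ y<z → each (m<n⇒m<1+n y<z)) rest n

Outlying : ℕ → ℕ → ℕ × ℕ → Set
Outlying k M b = 1 ≤ proj₁ b × 1 ≤ proj₂ b × (proj₂ b < k ⊎ M ≤ proj₂ b)

module Gap {x : ℕ} (k M : ℕ) (r : Str) (x≥1 : 1 ≤ x) (k≥1 : 1 ≤ k) where

  u v : Str
  u = 0^ x ++ 1^ k ++ r
  v = 0^ x ++ 1^ M

  -- The position of the first 1 decides: before x the string lies above v, after x below u;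
  -- at x, a 1-run of length at least M puts it above v and one shorter than k below u.
  notBetween-run : ∀ {z o w} → 1 ≤ o → NoLeadingOne w
    → (z ≡ x → M ≤ o ⊎ o < k ⊎ 1^ o ++ w ≡ 1^ k ++ r)
    → ¬ Between u v (0^ z ++ 1^ o ++ w)
  notBetween-run {z} {o} {w} o≥1 nl cond (u⊏w , w⊏v) with <-cmp z x
  ... | tri< z<x _ _ = ¬⊏-earlier-one w (1^ M) z<x o≥1 w⊏v
  ... | tri> _ _ x<z = ¬⊏-earlier-one r (1^ o ++ w) x<z k≥1 u⊏w
  ... | tri≈ _ refl _ with cond refl
  ...   | inj₁ M≤o = ¬⊏-ones-prefix w M≤o (⊏-++⁻ˡ (0^ x) w⊏v)
  ...   | inj₂ (inj₁ o<k) =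
          ⊏-irrefl u (⊏-trans u _ u u⊏w (⊏-++⁺ˡ (0^ x) (⊏-fewer-ones r o<k nl)))
  ...   | inj₂ (inj₂ same) = ⊏-irrefl u (subst (λ t → u ⊏ (0^ x ++ t)) same u⊏w)

  notBetween-block : ∀ z o {w} → 1 ≤ o → NoLeadingOne w
    → (x ≤ z → M ≤ o ⊎ o < k ⊎ 1^ o ++ w ≡ 1^ k ++ r)
    → NoSuffixBetween u v w → NoSuffixBetween u v (0^ z ++ 1^ o ++ w)
  notBetween-block z o {w} o≥1 nl cond rest =
    allSuffixes-replicate {¬_ ∘ Between u v} false z (1^ o ++ w) zeros
      (allSuffixes-replicate {¬_ ∘ Between u v} true o w ones rest)
    where
    zeros : ∀ {y} → y < z → ¬ Between u v (0^ (suc y) ++ 1^ o ++ w)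
    zeros y<z = notBetween-run o≥1 nl (λ 1+y≡x → cond (subst (_≤ z) 1+y≡x y<z))
    ones : ∀ {y} → y < o → ¬ Between u v (1^ (suc y) ++ w)
    ones _ = notBetween-run {0} (s≤s z≤n) nl (λ 0≡x → contradiction 0≡x (<⇒≢ x≥1))

  notBetween-runs : ∀ {L} → All (Outlying k M) L → NoSuffixBetween u v (runs L)
  notBetween-runs [] n = subst (¬_ ∘ Between u v) (sym (drop-[] n)) (λ (u⊏[] , _) → ⊏-[] u u⊏[])
  notBetween-runs {(z , o) ∷ L} ((_ , o≥1 , far) ∷ outs) =
    notBetween-block z o o≥1 (noLeadingOne outs) (λ _ → [ inj₂ ∘ inj₁ , inj₁ ]′ far)
      (notBetween-runs outs)
    where
    noLeadingOne : ∀ {L} → All (Outlying k M) L → NoLeadingOne (runs L)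
    noLeadingOne [] = []
    noLeadingOne ((z≥1 , _) ∷ _) = noLeadingOne-0^ _ z≥1

blockRuns : List ℕ → List (ℕ × ℕ)
blockRuns [] = []
blockRuns (a ∷ as) = (a , 2 + length as) ∷ blockRuns as

textRuns : ℕ → List ℕ → List (ℕ × ℕ)
textRuns m as = blockRuns as ++ (m * m + 1 , 1) ∷ (m * m , m + 2) ∷ []

blocks≡runs : ∀ m i as → i + length as ≡ suc m → blocks m i as ≡ runs (blockRuns as)
blocks≡runs m i [] _ = refl
blocks≡runs m i (a ∷ as) i+|a∷as|≡1+m =
  cong₂ (λ o w → 0^ a ++ 1^ o ++ w) ones (blocks≡runs m (suc i) as (cong suc i+|as|≡m))
  where
  i+|as|≡m : i + length as ≡ m
  i+|as|≡m = suc-injective (trans (sym (+-suc i (length as))) i+|a∷as|≡1+m)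
  ones : m ∸ i + 2 ≡ 2 + length as
  ones = begin
    m ∸ i + 2              ≡⟨ cong (λ n → n ∸ i + 2) i+|as|≡m ⟨
    i + length as ∸ i + 2  ≡⟨ cong (_+ 2) (m+n∸m≡n i (length as)) ⟩
    length as + 2          ≡⟨ +-comm (length as) 2 ⟩
    2 + length as          ∎

T≡runs : ∀ as → T (length as) as ≡ runs (textRuns (length as) as)
T≡runs as = begin
  T m as
    ≡⟨ cong₂ _++_ (blocks≡runs m 1 as refl) final ⟩
  runs (blockRuns as) ++ runs ((m * m + 1 , 1) ∷ (m * m , m + 2) ∷ [])
    ≡⟨ runs-++ (blockRuns as) _ ⟨
  runs (textRuns m as) ∎
  where
  m : ℕ
  m = length as
  final : (0^ (m * m + 1) ++ [ true ]) ++ 0^ (m * m) ++ 1^ (m + 2)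
        ≡ 0^ (m * m + 1) ++ 1^ 1 ++ 0^ (m * m) ++ 1^ (m + 2) ++ []
  final = trans (++-assoc (0^ (m * m + 1)) [ true ] _)
                (cong (λ w → 0^ (m * m + 1) ++ true ∷ 0^ (m * m) ++ w) (sym (++-identityʳ (1^ (m + 2)))))

drop-T : ∀ m as {x} → x ≤ m * m
  → drop (length (T m as) ∸ (m * m + m + 2) + m * m ∸ x) (T m as) ≡ 0^ x ++ 1^ (m + 2)
drop-T m as {x} x≤m² = begin
  drop (length (T m as) ∸ N + m * m ∸ x) (T m as) ≡⟨ cong₂ drop index T≡P++Q ⟩
  drop (length P + (m * m ∸ x)) (P ++ Q)          ≡⟨ drop-++ P (m * m ∸ x) ⟩
  drop (m * m ∸ x) Q                              ≡⟨ drop-∸-replicate-++ false (1^ (m + 2)) x≤m² ⟩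
  0^ x ++ 1^ (m + 2)                              ∎
  where
  N : ℕ
  N = m * m + m + 2
  P Q : Str
  P = blocks m 1 as ++ 0^ (m * m + 1) ++ [ true ]
  Q = 0^ (m * m) ++ 1^ (m + 2)
  T≡P++Q : T m as ≡ P ++ Q
  T≡P++Q = sym (++-assoc (blocks m 1 as) _ Q)
  |Q| : length Q ≡ N
  |Q| = begin
    length Q
      ≡⟨ length-++ (0^ (m * m)) ⟩
    length (0^ (m * m)) + length (1^ (m + 2))
      ≡⟨ cong₂ _+_ (length-replicate (m * m)) (length-replicate (m + 2)) ⟩
    m * m + (m + 2)
      ≡⟨ +-assoc (m * m) m 2 ⟨
    N ∎
  |T| : length (T m as) ≡ length P + N
  |T| = trans (cong length T≡P++Q) (trans (length-++ P) (cong (length P +_) |Q|))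
  index : length (T m as) ∸ N + m * m ∸ x ≡ length P + (m * m ∸ x)
  index = begin
    length (T m as) ∸ N + m * m ∸ x  ≡⟨ cong (λ n → n ∸ N + m * m ∸ x) |T| ⟩
    length P + N ∸ N + m * m ∸ x     ≡⟨ cong (λ n → n + m * m ∸ x) (m+n∸n≡m (length P) N) ⟩
    length P + m * m ∸ x             ≡⟨ +-∸-assoc (length P) x≤m² ⟩
    length P + (m * m ∸ x)           ∎

leadingBelow : ℕ → List ℕ → ℕ
leadingBelow x [] = 0
leadingBelow x (a ∷ as) = if a <ᵇ x then suc (leadingBelow x as) else 0

leadingBelow-≤ : ∀ x as → leadingBelow x as ≤ length as
leadingBelow-≤ x [] = z≤n
leadingBelow-≤ x (a ∷ as) with a <ᵇ x
... | true = s≤s (leadingBelow-≤ x as)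
... | false = z≤n

noLeadingOne-text : ∀ m {as} → All (1 ≤_) as → NoLeadingOne (runs (textRuns m as))
noLeadingOne-text m [] = noLeadingOne-0^ _ (m≤n+m 1 (m * m))
noLeadingOne-text m (a≥1 ∷ _) = noLeadingOne-0^ _ a≥1

outlying-last : ∀ {m k} → 1 ≤ m * m → All (Outlying k (m + 2)) ((m * m , m + 2) ∷ [])
outlying-last {m} m²≥1 = (m²≥1 , ≤-trans (s≤s z≤n) (m≤n+m 2 m) , inj₂ ≤-refl) ∷ []

outlying-text : ∀ {m k as} → 1 ≤ m * m → All (1 ≤_) as → suc (length as) < k
  → All (Outlying k (m + 2)) (textRuns m as)
outlying-text {m} m²≥1 [] 1<k = (m≤n+m 1 (m * m) , s≤s z≤n , inj₁ 1<k) ∷ outlying-last m²≥1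
outlying-text m²≥1 (a≥1 ∷ as≥1) |a∷as|<k =
  (a≥1 , s≤s z≤n , inj₁ |a∷as|<k) ∷ outlying-text m²≥1 as≥1 (<-trans (n<1+n _) |a∷as|<k)

predecessor-suffix : ∀ m x as → 1 ≤ x → x ≤ m * m → All (1 ≤_) as →
  let k = suc (length as) ∸ leadingBelow x as in
  ∃ λ r → NoLeadingOne r × Suffix (0^ x ++ 1^ k ++ r) (runs (textRuns m as))
        × NoSuffixBetween (0^ x ++ 1^ k ++ r) (0^ x ++ 1^ (m + 2)) (runs (textRuns m as))
predecessor-suffix m x [] x≥1 x≤m² [] =
  r , noLeadingOne-0^ _ m²≥1 ,
  suffix-replicate-++ (m * m + 1) false _ (≤-trans x≤m² (m≤m+n (m * m) 1)) ,
  notBetween-block (m * m + 1) 1 (s≤s z≤n) (noLeadingOne-0^ _ m²≥1) (λ _ → inj₂ (inj₂ refl))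
    (notBetween-runs (outlying-last m²≥1))
  where
  r : Str
  r = runs ((m * m , m + 2) ∷ [])
  m²≥1 : 1 ≤ m * m
  m²≥1 = ≤-trans x≥1 x≤m²
  open Gap 1 (m + 2) r x≥1 (s≤s z≤n)
predecessor-suffix m x (a ∷ as) x≥1 x≤m² (a≥1 ∷ as≥1) with a <ᵇ x | <ᵇ-reflects-< a x
... | false | ofⁿ a≮x =
  r , noLeadingOne-text m as≥1 , suffix-replicate-++ a false _ (≮⇒≥ a≮x) ,
  notBetween-block a (2 + length as) (s≤s z≤n) (noLeadingOne-text m as≥1) (λ _ → inj₂ (inj₂ refl))
    (notBetween-runs (outlying-text (≤-trans x≥1 x≤m²) as≥1 (n<1+n _)))
  where
  r : Str
  r = runs (textRuns m as)
  open Gap (2 + length as) (m + 2) r x≥1 (s≤s z≤n)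
... | true | ofʸ a<x with predecessor-suffix m x as x≥1 x≤m² as≥1
...   | r , nl , sfx , gap =
  r , nl , suffix-++ (0^ a) (suffix-++ (1^ (2 + length as)) sfx) ,
  notBetween-block a (2 + length as) (s≤s z≤n) (noLeadingOne-text m as≥1)
    (λ x≤a → contradiction x≤a (<⇒≱ a<x)) gap
  where
  open Gap (suc (length as) ∸ leadingBelow x as) (m + 2) r x≥1 (m<n⇒0<n∸m (s≤s (leadingBelow-≤ x as)))

PLCP-T : ∀ as x → All (1 ≤_) as → 1 ≤ x → x ≤ length as * length as →
  let m = length as in
  PLCP (T m as) (length (T m as) ∸ (m * m + m + 2) + m * m ∸ x + 1) ≡ x + (suc m ∸ leadingBelow x as)
PLCP-T as x as≥1 x≥1 x≤m² with predecessor-suffix (length as) x as x≥1 x≤m² as≥1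
... | r , nl , (i , drop≡u) , gap = begin
  PLCP S (j + 1)                               ≡⟨ cong (PLCP S) (+-comm j 1) ⟩
  PLCP S (suc j)                               ≡⟨ PLCP-predecessor S {j = j} i< drop≡u′ (drop-T m as x≤m²) u⊏v gap′ ⟩
  lcp (0^ x ++ 1^ (m + 2)) (0^ x ++ 1^ k ++ r) ≡⟨ lcp-++ˡ (0^ x) _ _ ⟩
  length (0^ x) + lcp (1^ (m + 2)) (1^ k ++ r) ≡⟨ cong₂ _+_ (length-replicate x) (lcp-fewer-ones k<m+2 nl) ⟩
  x + k                                        ∎
  where
  m k : ℕ
  m = length as
  k = suc m ∸ leadingBelow x as
  S : Str
  S = T m as
  j : ℕ
  j = length S ∸ (m * m + m + 2) + m * m ∸ x
  drop≡u′ : drop i S ≡ 0^ x ++ 1^ k ++ r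
  drop≡u′ = trans (cong (drop i) (T≡runs as)) drop≡u
  i< : i < length S
  i< = drop≢[]⇒< S (λ e → 0^-≢[] _ x≥1 (trans (sym drop≡u′) e))
  gap′ : NoSuffixBetween (0^ x ++ 1^ k ++ r) (0^ x ++ 1^ (m + 2)) S
  gap′ = subst (NoSuffixBetween (0^ x ++ 1^ k ++ r) (0^ x ++ 1^ (m + 2))) (sym (T≡runs as)) gap
  k<m+2 : k < m + 2
  k<m+2 = ≤-trans (s≤s (m∸n≤m (suc m) (leadingBelow x as))) (≤-reflexive (+-comm 2 m))
  u⊏v : 0^ x ++ 1^ k ++ r ⊏ 0^ x ++ 1^ (m + 2)
  u⊏v = ⊏-++⁺ˡ (0^ x) (subst (1^ k ++ r ⊏_) (++-identityʳ (1^ (m + 2))) (⊏-fewer-ones [] k<m+2 nl))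

Pred-≥ : ∀ {x as} → All (x ≤_) as → Pred as x ≡ nothing
Pred-≥ [] = refl
Pred-≥ {x} {a ∷ _} (x≤a ∷ x≤as) with a <ᵇ x | <ᵇ-reflects-< a x
... | true | ofʸ a<x = contradiction x≤a (<⇒≱ a<x)
... | false | ofⁿ _ = Pred-≥ x≤as

maxM-nth : ∀ {a as} i → All (a <_) as → i < length as → maxM (just a) (nth as i) ≡ nth as i
maxM-nth zero (a<b ∷ _) _ = cong just (m≤n⇒m⊔n≡n (<⇒≤ a<b))
maxM-nth (suc i) (_ ∷ a<as) (s≤s i<) = maxM-nth i a<as i<

maxM-elt : ∀ {a as} i → All (a <_) as → i ≤ length as → maxM (just a) (elt as i) ≡ elt (a ∷ as) (suc i)
maxM-elt zero _ _ = refl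
maxM-elt (suc i) a<as i< = maxM-nth i a<as i<

sorted-head : ∀ {a as} → Linked _<_ (a ∷ as) → All (a <_) as
sorted-head = AllPairs.head ∘ Linked⇒AllPairs <-trans

Pred-sorted : ∀ x {as} → Linked _<_ as → Pred as x ≡ elt as (leadingBelow x as)
Pred-sorted x {[]} _ = refl
Pred-sorted x {a ∷ as} sorted with a <ᵇ x | <ᵇ-reflects-< a x
... | false | ofⁿ a≮x =
  Pred-≥ (All.map (λ a<b → ≤-trans (≮⇒≥ a≮x) (<⇒≤ a<b)) (sorted-head sorted))
... | true | ofʸ _ = trans (cong (maxM (just a)) (Pred-sorted x (Linked.tail sorted)))
                           (maxM-elt (leadingBelow x as) (sorted-head sorted) (leadingBelow-≤ x as))

mainTheorem12 : (m : ℕ) (as : List ℕ) → 1 ≤ m → length as ≡ m → Linked _<_ as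
    → All (λ a → 1 ≤ a × a ≤ m * m) as
    → (x : ℕ) → 1 ≤ x → x ≤ m * m
    → PLCP (T m as) ((length (T m as) ∸ (m * m + m + 2)) + (m * m) ∸ x + 1) ≤ x + m + 1
    × Pred as x ≡ elt as ((x + m + 1) ∸ PLCP (T m as) ((length (T m as) ∸ (m * m + m + 2)) + (m * m) ∸ x + 1))
mainTheorem12 .(length as) as _ refl sorted bounds x x≥1 x≤m²
  rewrite PLCP-T as x (All.map proj₁ bounds) x≥1 x≤m² =
  ≤-trans (+-monoʳ-≤ x (m∸n≤m (suc m) i)) (≤-reflexive x+[1+m]≡x+m+1) ,
  trans (Pred-sorted x sorted) (cong (elt as) (sym index))
  where
  m i : ℕ
  m = length as
  i = leadingBelow x as
  x+[1+m]≡x+m+1 : x + suc m ≡ x + m + 1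
  x+[1+m]≡x+m+1 = trans (+-suc x m) (+-comm 1 (x + m))
  index : x + m + 1 ∸ (x + (suc m ∸ i)) ≡ i
  index = begin
    x + m + 1 ∸ (x + (suc m ∸ i)) ≡⟨ cong (_∸ (x + (suc m ∸ i))) x+[1+m]≡x+m+1 ⟨
    x + suc m ∸ (x + (suc m ∸ i)) ≡⟨ [m+n]∸[m+o]≡n∸o x (suc m) (suc m ∸ i) ⟩
    suc m ∸ (suc m ∸ i)           ≡⟨ m∸[m∸n]≡n (m≤n⇒m≤1+n (leadingBelow-≤ x as)) ⟩
    i                             ∎
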